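{- For every integer $n\geq 2$ there exists a balanced bipartite graph $\mathcal{B}$ on $2n$ vertices with minimum degree $\delta(\mathcal{B})=\lceil \frac{n}{2}\rceil$ and $f(\mathcal{B})=n+2$.
   Context: All graphs are finite and simple. A balanced bipartite graph on $2n$ vertices is a bipartite graph with a bipartition into two parts $V_1,V_2$ with $|V_1|=|V_2|=n$. The forest number $f(G)$ is the maximum cardinality of a set $S\subseteq V(G)$ such that the induced subgraph $G[S]$ is a forest. -}

module Defs where

open import Data.Nat using (ℕ; zero; suc; _+_; _≤_; _≥_; _/_)
open import Data.Bool using (Bool; true; false)
open import Data.Fin using (Fin)
open import Data.Fin.Subset using (Subset; _∈_; _∉_; ∣_∣)
open import Data.Vec using (Vec; tabulate)
open import Data.List using (List; []; _∷_; length)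
open import Data.List.Relation.Unary.All using (All)
open import Data.List.Relation.Unary.Unique.Propositional using (Unique)
open import Data.Product using (Σ; _×_; ∃; ∃-syntax)
open import Data.Sum using (_⊎_)
open import Data.Unit using (⊤)
open import Data.Empty using (⊥)
open import Relation.Binary.PropositionalEquality using (_≡_; _≢_)

record Graph (m : ℕ) : Set where
  field
    adj   : Fin m → Fin m → Bool
    sym   : ∀ u v → adj u v ≡ adj v u
    irrefl : ∀ v → adj v v ≡ false
open Graph public

Adjacent : ∀ {m} → Graph m → Fin m → Fin m → Set
Adjacent G u v = adj G u v ≡ true

degree : ∀ {m} → Graph m → Fin m → ℕ
degree G v = ∣ tabulate (adj G v) ∣

MinDegree : ∀ {m} → Graph m → ℕ → Set
MinDegree G d = (∃[ v ] degree G v ≡ d) × (∀ v → d ≤ degree G v)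

-- G is a balanced bipartite graph with parts of size n (on 2n = n + n vertices):
-- there is a side-assignment P (true = V₁, false = V₂) with |V₁| = n
-- (hence |V₂| = n) and every edge joins the two sides.
BalancedBipartite : ∀ (n : ℕ) → Graph (n + n) → Set
BalancedBipartite n G =
  Σ (Subset (n + n)) λ P →
    (∣ P ∣ ≡ n) × (∀ u v → Adjacent G u v → (u ∈ P × v ∉ P) ⊎ (u ∉ P × v ∈ P))

private
  PathAdj : ∀ {m} → Graph m → Fin m → List (Fin m) → Set
  PathAdj G x [] = ⊤
  PathAdj G x (y ∷ ys) = Adjacent G x y × PathAdj G y ys

  last : ∀ {A : Set} → A → List A → A
  last x [] = x
  last x (y ∷ ys) = last y ys

IsCycle : ∀ {m} → Graph m → List (Fin m) → Set
IsCycle G [] = ⊥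
IsCycle G (x ∷ xs) =
  (3 ≤ length (x ∷ xs)) × Unique (x ∷ xs) × PathAdj G x xs × Adjacent G (last x xs) x

-- G[S] is a forest: no cycle of G lies entirely inside S
-- (cycles of the induced subgraph G[S] are exactly the cycles of G within S).
InducesForest : ∀ {m} → Graph m → Subset m → Set
InducesForest {m} G S = ∀ (c : List (Fin m)) → All (_∈ S) c → IsCycle G c → ⊥


ForestNumber : ∀ {m} → Graph m → ℕ → Set
ForestNumber G k =
  (∃[ S ] (InducesForest G S × ∣ S ∣ ≡ k)) ×
  (∀ S → InducesForest G S → ∣ S ∣ ≤ k)

⌈_/2⌉ : ℕ → ℕ
⌈ n /2⌉ = suc n / 2

module Submission where

-- B is the disjoint union of the complete bipartite graphs K_{p,p} and K_{q,q}, where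
-- p = ⌈n/2⌉ and q = ⌊n/2⌋, except that for odd n one vertex on each side of K_{p,p}
-- (a hub) is also joined to the opposite side of K_{q,q}, raising the degrees there to p.
-- A forest contains at most one vertex from some side of each complete bipartite block,
-- since two on both sides span a 4-cycle; hence f(B) ≤ (p + 1) + (q + 1) = n + 2.
-- Conversely, one side of B together with one vertex c₁, c₂ of the other side in each
-- block induces a forest: every induced edge meets {c₁, c₂}, and c₁ and c₂ have at most
-- one common neighbour, the hub.

open import Algebra.Properties.CommutativeSemigroup using (x∙yz≈y∙xz)
open import Data.Bool using (Bool; true; false; not; _∧_; _∨_; _xor_; if_then_else_)
open import Data.Bool.Properties using (¬-not; xor-comm; xor-same; ∨-comm)
open import Data.Empty using (⊥; ⊥-elim)
open import Data.Fin using (Fin; toℕ; zero; suc; fromℕ<; _≟_)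
open import Data.Fin.Properties using (suc-injective; toℕ-fromℕ<)
open import Data.Fin.Subset using (Subset; _∈_; _∉_; ∣_∣; _∩_; ∁; Nonempty; inside; outside)
open import Data.Fin.Subset.Properties using (∩-assoc; ∣p∩q∣≤∣q∣; ∣p∣≤∣x∷p∣; x∈p∩q⁻; x∈∁p⇒x∉p)
open import Data.List using (List; []; _∷_; _++_)
open import Data.List.Relation.Unary.All using ([]; _∷_)
open import Data.List.Relation.Unary.AllPairs using ([]; _∷_)
open import Data.Nat using (ℕ; zero; suc; _+_; _≤_; _<_; _≤?_; z≤n; s≤s)
open import Data.Nat.DivMod using (m/n≡1+[m∸n]/n)
open import Data.Nat.Properties
  using ( +-assoc; +-comm; +-suc; +-identityʳ; +-commutativeSemigroup; +-mono-≤; +-monoʳ-≤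
        ; m≤m+n; ≤-refl; ≤-reflexive; ≤-trans; ≰⇒>; module ≤-Reasoning)
open import Data.Nat.Tactic.RingSolver using (solve-∀)
open import Data.Product using (Σ; ∃₂; _×_; _,_; proj₁; proj₂)
open import Data.Sum using (_⊎_; inj₁; inj₂)
open import Data.Unit using (tt)
open import Data.Vec using ([]; _∷_; tabulate; here; there)
open import Data.Vec.Properties using (lookup∘tabulate; []=⇒lookup; lookup⇒[]=; tabulate-∘)
open import Function using (_∘_; _$_; const; case_of_)
open import Relation.Binary.PropositionalEquality
open import Relation.Nullary using (¬_; Dec; yes; no)
open import Relation.Nullary.Decidable using (_⊎-dec_)

open import Defs hiding (sym)

countBelow : ℕ → (ℕ → Bool) → ℕ
countBelow zero    f = 0
countBelow (suc m) f = (if f 0 then 1 else 0) + countBelow m (f ∘ suc)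

∣tabulate∘toℕ∣ : ∀ m (f : ℕ → Bool) → ∣ tabulate {n = m} (f ∘ toℕ) ∣ ≡ countBelow m f
∣tabulate∘toℕ∣ zero    f = refl
∣tabulate∘toℕ∣ (suc m) f with f 0
... | true  = cong suc (∣tabulate∘toℕ∣ m (f ∘ suc))
... | false = ∣tabulate∘toℕ∣ m (f ∘ suc)

∣p∣≡∣p∩q∣+∣p∩∁q∣ : ∀ {m} (p q : Subset m) → ∣ p ∣ ≡ ∣ p ∩ q ∣ + ∣ p ∩ ∁ q ∣
∣p∣≡∣p∩q∣+∣p∩∁q∣ []            []            = refl
∣p∣≡∣p∩q∣+∣p∩∁q∣ (outside ∷ p) (_ ∷ q)       = ∣p∣≡∣p∩q∣+∣p∩∁q∣ p q
∣p∣≡∣p∩q∣+∣p∩∁q∣ (inside ∷ p)  (inside ∷ q)  = cong suc (∣p∣≡∣p∩q∣+∣p∩∁q∣ p q)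
∣p∣≡∣p∩q∣+∣p∩∁q∣ (inside ∷ p)  (outside ∷ q) =
  trans (cong suc (∣p∣≡∣p∩q∣+∣p∩∁q∣ p q)) (sym (+-suc _ _))

∣p∣>0⇒nonempty : ∀ {m} (p : Subset m) → 0 < ∣ p ∣ → Nonempty p
∣p∣>0⇒nonempty (inside ∷ p)  _ = zero , here
∣p∣>0⇒nonempty (outside ∷ p) h with ∣p∣>0⇒nonempty p h
... | x , x∈p = suc x , there x∈p

∣p∣≥2⇒distinct : ∀ {m} (p : Subset m) → 2 ≤ ∣ p ∣ → ∃₂ λ x y → x ≢ y × x ∈ p × y ∈ p
∣p∣≥2⇒distinct (inside ∷ p) (s≤s h) with ∣p∣>0⇒nonempty p h
... | y , y∈p = zero , suc y , (λ ()) , here , there y∈p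
∣p∣≥2⇒distinct (outside ∷ p) h with ∣p∣≥2⇒distinct p h
... | x , y , x≢y , x∈p , y∈p = suc x , suc y , x≢y ∘ suc-injective , there x∈p , there y∈p

x∈p⇒∣p∣>0 : ∀ {m} {p : Subset m} {x} → x ∈ p → 0 < ∣ p ∣
x∈p⇒∣p∣>0 {p = inside ∷ p}  _           = s≤s z≤n
x∈p⇒∣p∣>0 {p = outside ∷ p} (there x∈p) = x∈p⇒∣p∣>0 x∈p

∣p∣≤1⇒x≡y : ∀ {m} {p : Subset m} {x y} → ∣ p ∣ ≤ 1 → x ∈ p → y ∈ p → x ≡ y
∣p∣≤1⇒x≡y {p = s ∷ p} h (there x∈p) (there y∈p) =
  cong suc (∣p∣≤1⇒x≡y (≤-trans (∣p∣≤∣x∷p∣ s p) h) x∈p y∈p)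
∣p∣≤1⇒x≡y _ here here = refl
∣p∣≤1⇒x≡y (s≤s h) here (there y∈p) with ≤-trans (x∈p⇒∣p∣>0 y∈p) h
... | ()
∣p∣≤1⇒x≡y (s≤s h) (there x∈p) here with ≤-trans (x∈p⇒∣p∣>0 x∈p) h
... | ()

∈tabulate⁺ : ∀ {m} {f : Fin m → Bool} {x} → f x ≡ true → x ∈ tabulate f
∈tabulate⁺ {f = f} {x} fx = lookup⇒[]= x (tabulate f) (trans (lookup∘tabulate f x) fx)

∈tabulate⁻ : ∀ {m} {f : Fin m → Bool} {x} → x ∈ tabulate f → f x ≡ true
∈tabulate⁻ {f = f} {x} x∈ = trans (sym (lookup∘tabulate f x)) ([]=⇒lookup x∈)

∉tabulate : ∀ {m} {f : Fin m → Bool} {x} → f x ≡ false → x ∉ tabulate f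
∉tabulate fx x∈ with trans (sym fx) (∈tabulate⁻ x∈)
... | ()

∈∁tabulate⁻ : ∀ {m} {f : Fin m → Bool} {x} → x ∈ ∁ (tabulate f) → f x ≡ false
∈∁tabulate⁻ x∈ = ¬-not (x∈∁p⇒x∉p x∈ ∘ ∈tabulate⁺)

tabulate-∩ : ∀ {m} (f g : Fin m → Bool) → tabulate f ∩ tabulate g ≡ tabulate (λ i → f i ∧ g i)
tabulate-∩ {zero}  f g = refl
tabulate-∩ {suc m} f g = cong (f zero ∧ g zero ∷_) (tabulate-∩ (f ∘ suc) (g ∘ suc))

tabulate-∁ : ∀ {m} (f : Fin m → Bool) → ∁ (tabulate f) ≡ tabulate (not ∘ f)
tabulate-∁ f = sym (tabulate-∘ not f)

-- Layouts
-- A layout (l₁ , a₁) ∷ (l₂ , a₂) ∷ … labels the positions 0, 1, … by l₁ copies of a₁, then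
-- l₂ copies of a₂, and so on; `labelAt L d` gives the positions past `span L` the label d.

Layout : Set → Set
Layout A = List (ℕ × A)

span : ∀ {A} → Layout A → ℕ
span []            = 0
span ((l , _) ∷ L) = l + span L

prepend : ∀ {A : Set} → ℕ → A → (ℕ → A) → ℕ → A
prepend zero    a f i       = f i
prepend (suc l) a f zero    = a
prepend (suc l) a f (suc i) = prepend l a f i

labelAt : ∀ {A} → Layout A → A → ℕ → A
labelAt []            d = const d
labelAt ((l , a) ∷ L) d = prepend l a (labelAt L d)

countLabel : ∀ {A} → Layout A → (A → Bool) → ℕ
countLabel []            P = 0
countLabel ((l , a) ∷ L) P = (if P a then l else 0) + countLabel L P

span≡countLabel+countLabel¬ : ∀ {A} (L : Layout A) P → span L ≡ countLabel L P + countLabel L (not ∘ P)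
span≡countLabel+countLabel¬ []            P = refl
span≡countLabel+countLabel¬ ((l , a) ∷ L) P with P a
... | true  = trans (cong (l +_) (span≡countLabel+countLabel¬ L P)) (sym (+-assoc l _ _))
... | false = trans (cong (l +_) (span≡countLabel+countLabel¬ L P))
                    (x∙yz≈y∙xz +-commutativeSemigroup l (countLabel L P) (countLabel L (not ∘ P)))

prepend-+ : ∀ {A : Set} l (a : A) f i → prepend l a f (l + i) ≡ f i
prepend-+ zero    a f i = refl
prepend-+ (suc l) a f i = prepend-+ l a f i

countBelow-prepend : ∀ {A : Set} l (a : A) f m (P : A → Bool) {b} → P a ≡ b →
  countBelow (l + m) (P ∘ prepend l a f) ≡ (if b then l else 0) + countBelow m (P ∘ f)
countBelow-prepend zero    a f m P {true}  _  = refl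
countBelow-prepend zero    a f m P {false} _  = refl
countBelow-prepend (suc l) a f m P {b}     eq rewrite eq with b | countBelow-prepend l a f m P eq
... | true  | ih = cong suc ih
... | false | ih = ih

countBelow-labelAt : ∀ {A} (L : Layout A) d P → countBelow (span L) (P ∘ labelAt L d) ≡ countLabel L P
countBelow-labelAt []            d P = refl
countBelow-labelAt ((l , a) ∷ L) d P =
  trans (countBelow-prepend l a (labelAt L d) (span L) P refl)
        (cong ((if P a then l else 0) +_) (countBelow-labelAt L d P))

∣tabulate∘labelAt∣ : ∀ {A m} (L : Layout A) d P → m ≡ span L →
  ∣ tabulate {n = m} (λ v → P (labelAt L d (toℕ v))) ∣ ≡ countLabel L P
∣tabulate∘labelAt∣ L d P refl =
  trans (∣tabulate∘toℕ∣ (span L) (P ∘ labelAt L d)) (countBelow-labelAt L d P)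

span-++ : ∀ {A} (L₁ L₂ : Layout A) → span (L₁ ++ L₂) ≡ span L₁ + span L₂
span-++ []             L₂ = refl
span-++ ((l , _) ∷ L₁) L₂ = trans (cong (l +_) (span-++ L₁ L₂)) (sym (+-assoc l _ _))

labelAt-++ : ∀ {A} (L₁ L₂ : Layout A) d i → labelAt (L₁ ++ L₂) d (span L₁ + i) ≡ labelAt L₂ d i
labelAt-++ []             L₂ d i = refl
labelAt-++ ((l , a) ∷ L₁) L₂ d i rewrite +-assoc l (span L₁) i =
  trans (prepend-+ l a (labelAt (L₁ ++ L₂) d) (span L₁ + i)) (labelAt-++ L₁ L₂ d i)

labelled-position : ∀ {A m} (L : Layout A) d → m ≡ span L →
  ∀ L₁ {l a L₂} → L ≡ L₁ ++ (suc l , a) ∷ L₂ → Σ (Fin m) λ v → labelAt L d (toℕ v) ≡ a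
labelled-position L d refl L₁ {l} {a} {L₂} refl =
  fromℕ< bound , (begin
    labelAt L d (toℕ (fromℕ< bound)) ≡⟨ cong (labelAt L d) (toℕ-fromℕ< bound) ⟩
    labelAt L d (span L₁)            ≡⟨ cong (labelAt L d) (+-identityʳ (span L₁)) ⟨
    labelAt L d (span L₁ + 0)        ≡⟨ labelAt-++ L₁ ((suc l , a) ∷ L₂) d 0 ⟩
    a                                ∎)
  where
  open ≡-Reasoning
  bound : span L₁ < span L
  bound = subst (span L₁ <_) (sym (span-++ L₁ _))
                (subst (suc (span L₁) ≤_) (sym (+-suc (span L₁) _)) (s≤s (m≤m+n _ _)))

adjacent-sym : ∀ {m} (G : Graph m) {u v} → Adjacent G u v → Adjacent G v u
adjacent-sym G {u} {v} a = trans (Graph.sym G v u) a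

adjacent⇒≢ : ∀ {m} (G : Graph m) {u v} → Adjacent G u v → u ≢ v
adjacent⇒≢ G {u} a refl with trans (sym a) (irrefl G u)
... | ()

forest-meets-complete-pair : ∀ {m} (G : Graph m) {S X Y : Subset m} → InducesForest G S →
  (∀ {x y} → x ∈ X → y ∈ Y → Adjacent G x y) → ∣ S ∩ X ∣ ≤ 1 ⊎ ∣ S ∩ Y ∣ ≤ 1
forest-meets-complete-pair G {S} {X} {Y} forest complete
  with ∣ S ∩ X ∣ ≤? 1 | ∣ S ∩ Y ∣ ≤? 1
... | yes few | _       = inj₁ few
... | no _    | yes few = inj₂ few
... | no manyX | no manyY
  with ∣p∣≥2⇒distinct (S ∩ X) (≰⇒> manyX) | ∣p∣≥2⇒distinct (S ∩ Y) (≰⇒> manyY)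
... | a , a′ , a≢a′ , a∈ , a′∈ | b , b′ , b≢b′ , b∈ , b′∈ = ⊥-elim $
  forest (a ∷ b ∷ a′ ∷ b′ ∷ []) (inS a∈ ∷ inS b∈ ∷ inS a′∈ ∷ inS b′∈ ∷ [])
    ( s≤s (s≤s (s≤s z≤n))
    , ( (adjacent⇒≢ G ab ∷ a≢a′ ∷ adjacent⇒≢ G ab′ ∷ [])
      ∷ (adjacent⇒≢ G (adjacent-sym G a′b) ∷ b≢b′ ∷ [])
      ∷ (adjacent⇒≢ G a′b′ ∷ [])
      ∷ [] ∷ [])
    , (ab , adjacent-sym G a′b , a′b′ , tt)
    , adjacent-sym G ab′ )
  where
  inS : ∀ {x} {T} → x ∈ S ∩ T → x ∈ S
  inS {T = T} x∈ = proj₁ (x∈p∩q⁻ S T x∈)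
  edge : ∀ {x y} → x ∈ S ∩ X → y ∈ S ∩ Y → Adjacent G x y
  edge x∈ y∈ = complete (proj₂ (x∈p∩q⁻ S X x∈)) (proj₂ (x∈p∩q⁻ S Y y∈))
  ab : Adjacent G a b
  ab = edge a∈ b∈
  ab′ : Adjacent G a b′
  ab′ = edge a∈ b′∈
  a′b : Adjacent G a′ b
  a′b = edge a′∈ b∈
  a′b′ : Adjacent G a′ b′
  a′b′ = edge a′∈ b′∈

forest-within-complete-bipartite : ∀ {m} (G : Graph m) {S W A : Subset m} {k} → InducesForest G S →
  (∀ {x y} → x ∈ W ∩ A → y ∈ W ∩ ∁ A → Adjacent G x y) →
  ∣ W ∩ A ∣ ≤ k → ∣ W ∩ ∁ A ∣ ≤ k → ∣ S ∩ W ∣ ≤ suc k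
forest-within-complete-bipartite G {S} {W} {A} {k} forest complete ∣X∣≤k ∣Y∣≤k = begin
  ∣ S ∩ W ∣                            ≡⟨ ∣p∣≡∣p∩q∣+∣p∩∁q∣ (S ∩ W) A ⟩
  ∣ (S ∩ W) ∩ A ∣ + ∣ (S ∩ W) ∩ ∁ A ∣
    ≡⟨ cong₂ _+_ (cong ∣_∣ (∩-assoc S W A)) (cong ∣_∣ (∩-assoc S W (∁ A))) ⟩
  ∣ S ∩ W ∩ A ∣ + ∣ S ∩ W ∩ ∁ A ∣     ≤⟨ sum≤ (forest-meets-complete-pair G forest complete) ⟩
  suc k                                ∎
  where
  open ≤-Reasoning
  sum≤ : ∣ S ∩ (W ∩ A) ∣ ≤ 1 ⊎ ∣ S ∩ (W ∩ ∁ A) ∣ ≤ 1 → ∣ S ∩ (W ∩ A) ∣ + ∣ S ∩ (W ∩ ∁ A) ∣ ≤ suc k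
  sum≤ (inj₁ x≤1) = +-mono-≤ x≤1 (≤-trans (∣p∩q∣≤∣q∣ S (W ∩ ∁ A)) ∣Y∣≤k)
  sum≤ (inj₂ y≤1) = subst (∣ S ∩ W ∩ A ∣ + ∣ S ∩ W ∩ ∁ A ∣ ≤_) (+-comm k 1)
                          (+-mono-≤ (≤-trans (∣p∩q∣≤∣q∣ S (W ∩ A)) ∣X∣≤k) y≤1)

-- Every edge of G[S] has exactly one end in {c, c′}, so cycles in S alternate between centres
-- and other vertices. Hence they have even length, a 4-cycle would give c and c′ two common
-- neighbours, and a longer cycle has three distinct centres among its first six vertices.
twoCentres⇒forest : ∀ {m} (G : Graph m) (S : Subset m) (c c′ : Fin m) →
  (∀ {u v} → u ∈ S → v ∈ S → Adjacent G u v → (u ≡ c ⊎ u ≡ c′) ⊎ (v ≡ c ⊎ v ≡ c′)) →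
  ¬ Adjacent G c c′ →
  (∀ {u w} → u ∈ S → w ∈ S →
     Adjacent G u c → Adjacent G u c′ → Adjacent G w c → Adjacent G w c′ → u ≡ w) →
  InducesForest G S
twoCentres⇒forest {m} G S c c′ cover c≁c′ shared = cycle-free
  where
  Centre : Fin m → Set
  Centre u = u ≡ c ⊎ u ≡ c′

  centre? : ∀ u → Dec (Centre u)
  centre? u = (u ≟ c) ⊎-dec (u ≟ c′)

  independent : ∀ {u v} → Centre u → Centre v → ¬ Adjacent G u v
  independent (inj₁ refl) (inj₁ refl) a = adjacent⇒≢ G a refl
  independent (inj₁ refl) (inj₂ refl)   = c≁c′
  independent (inj₂ refl) (inj₁ refl)   = c≁c′ ∘ adjacent-sym G
  independent (inj₂ refl) (inj₂ refl) a = adjacent⇒≢ G a refl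

  no-three : ∀ {x y z} → Centre x → Centre y → Centre z → x ≢ y → x ≢ z → y ≢ z → ⊥
  no-three (inj₁ refl) (inj₁ refl) _           x≢y _   _   = x≢y refl
  no-three (inj₂ refl) (inj₂ refl) _           x≢y _   _   = x≢y refl
  no-three (inj₁ refl) (inj₂ refl) (inj₁ refl) _   x≢z _   = x≢z refl
  no-three (inj₁ refl) (inj₂ refl) (inj₂ refl) _   _   y≢z = y≢z refl
  no-three (inj₂ refl) (inj₁ refl) (inj₁ refl) _   _   y≢z = y≢z refl
  no-three (inj₂ refl) (inj₁ refl) (inj₂ refl) _   x≢z _   = x≢z refl

  shared′ : ∀ {x z u w} → Centre x → Centre z → x ≢ z → u ∈ S → w ∈ S →
    Adjacent G u x → Adjacent G u z → Adjacent G w x → Adjacent G w z → u ≡ w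
  shared′ (inj₁ refl) (inj₂ refl) _   u∈ w∈ ux uz wx wz = shared u∈ w∈ ux uz wx wz
  shared′ (inj₂ refl) (inj₁ refl) _   u∈ w∈ ux uz wx wz = shared u∈ w∈ uz ux wz wx
  shared′ (inj₁ refl) (inj₁ refl) x≢z = ⊥-elim (x≢z refl)
  shared′ (inj₂ refl) (inj₂ refl) x≢z = ⊥-elim (x≢z refl)

  centre-after-plain : ∀ {u v} → u ∈ S → v ∈ S → Adjacent G u v → ¬ Centre u → Centre v
  centre-after-plain u∈ v∈ uv ¬cu with cover u∈ v∈ uv
  ... | inj₁ cu = ⊥-elim (¬cu cu)
  ... | inj₂ cv = cv

  plain-after-centre : ∀ {u v} → Centre u → Adjacent G u v → ¬ Centre v
  plain-after-centre cu uv cv = independent cu cv uv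

  cycle-free : InducesForest G S
  cycle-free [] _ ()
  cycle-free (x ∷ []) _ (s≤s () , _)
  cycle-free (x ∷ y ∷ []) _ (s≤s (s≤s ()) , _)
  cycle-free (x ∷ y ∷ z ∷ []) (x∈ ∷ y∈ ∷ z∈ ∷ []) (_ , _ , (xy , yz , _) , zx) with centre? x
  ... | yes cx = independent cz cx zx
    where cz : Centre z
          cz = centre-after-plain y∈ z∈ yz (plain-after-centre cx xy)
  ... | no ¬cx = ¬cx (centre-after-plain z∈ x∈ zx (plain-after-centre cy yz))
    where cy : Centre y
          cy = centre-after-plain x∈ y∈ xy ¬cx
  cycle-free (x ∷ y ∷ z ∷ w ∷ []) (x∈ ∷ y∈ ∷ z∈ ∷ w∈ ∷ [])
    (_ , ((_ ∷ x≢z ∷ _ ∷ []) ∷ (_ ∷ y≢w ∷ []) ∷ _) , (xy , yz , zw , _) , wx) with centre? x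
  ... | yes cx = y≢w (shared′ cx cz x≢z y∈ w∈ (adjacent-sym G xy) yz wx (adjacent-sym G zw))
    where cz : Centre z
          cz = centre-after-plain y∈ z∈ yz (plain-after-centre cx xy)
  ... | no ¬cx = x≢z (shared′ cy cw y≢w x∈ z∈ xy (adjacent-sym G wx) (adjacent-sym G yz) zw)
    where cy : Centre y
          cy = centre-after-plain x∈ y∈ xy ¬cx
          cw : Centre w
          cw = centre-after-plain z∈ w∈ zw (plain-after-centre cy yz)
  cycle-free (x ∷ y ∷ z ∷ w ∷ v ∷ []) (x∈ ∷ y∈ ∷ z∈ ∷ w∈ ∷ v∈ ∷ [])
    (_ , ((_ ∷ x≢z ∷ _ ∷ x≢v ∷ []) ∷ _ ∷ (_ ∷ z≢v ∷ []) ∷ _) , (xy , yz , zw , wv , _) , vx)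
    with centre? x
  ... | yes cx = no-three cx cz cv x≢z x≢v z≢v
    where cz : Centre z
          cz = centre-after-plain y∈ z∈ yz (plain-after-centre cx xy)
          cv : Centre v
          cv = centre-after-plain w∈ v∈ wv (plain-after-centre cz zw)
  ... | no ¬cx = ¬cx (centre-after-plain v∈ x∈ vx (plain-after-centre cw wv))
    where cy : Centre y
          cy = centre-after-plain x∈ y∈ xy ¬cx
          cw : Centre w
          cw = centre-after-plain z∈ w∈ zw (plain-after-centre cy yz)
  cycle-free (x ∷ y ∷ z ∷ w ∷ v ∷ t ∷ _) (x∈ ∷ y∈ ∷ z∈ ∷ w∈ ∷ v∈ ∷ t∈ ∷ _)
    (_ , ((_ ∷ x≢z ∷ _ ∷ x≢v ∷ _) ∷ (_ ∷ y≢w ∷ _ ∷ y≢t ∷ _) ∷ (_ ∷ z≢v ∷ _) ∷ (_ ∷ w≢t ∷ _) ∷ _) ,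
     (xy , yz , zw , wv , vt , _) , _)
    with centre? x
  ... | yes cx = no-three cx cz cv x≢z x≢v z≢v
    where cz : Centre z
          cz = centre-after-plain y∈ z∈ yz (plain-after-centre cx xy)
          cv : Centre v
          cv = centre-after-plain w∈ v∈ wv (plain-after-centre cz zw)
  ... | no ¬cx = no-three cy cw ct y≢w y≢t w≢t
    where cy : Centre y
          cy = centre-after-plain x∈ y∈ xy ¬cx
          cw : Centre w
          cw = centre-after-plain z∈ w∈ zw (plain-after-centre cy yz)
          ct : Centre t
          ct = centre-after-plain v∈ t∈ vt (plain-after-centre cw wv)

-- Side A consists of the kinds hubA, a₁, a₂ and side B of hubB, c₁, b₁, c₂, b₂; the
-- index 1 or 2 (hubs: 1) is the block. Vertices on opposite sides are joined when they lie
-- in the same block or one of them is a hub. In `layout e r`, with q = r + 1, each side has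
-- e + q vertices in block 1 and q in block 2; the hubs are present only when e = 1.

data Kind : Set where
  hubA a₁ a₂ hubB c₁ b₁ c₂ b₂ : Kind

onA : Kind → Bool
onA hubA = true
onA a₁   = true
onA a₂   = true
onA _    = false

inBlock₁ : Kind → Bool
inBlock₁ a₂ = false
inBlock₁ c₂ = false
inBlock₁ b₂ = false
inBlock₁ _  = true

isHub : Kind → Bool
isHub hubA = true
isHub hubB = true
isHub _    = false

isCentre : Kind → Bool
isCentre c₁ = true
isCentre c₂ = true
isCentre _  = false

inForest : Kind → Bool
inForest k = onA k ∨ isCentre k

joined : Kind → Kind → Bool
joined k l = (onA k xor onA l) ∧ (not (inBlock₁ k xor inBlock₁ l) ∨ (isHub k ∨ isHub l))

joined-sym : ∀ k l → joined k l ≡ joined l k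
joined-sym k l = cong₂ _∧_ (xor-comm (onA k) (onA l))
  (cong₂ _∨_ (cong not (xor-comm (inBlock₁ k) (inBlock₁ l))) (∨-comm (isHub k) (isHub l)))

joined-irrefl : ∀ k → joined k k ≡ false
joined-irrefl k rewrite xor-same (onA k) = refl

joined⇒opposite : ∀ k l → joined k l ≡ true →
  (onA k ≡ true × onA l ≡ false) ⊎ (onA k ≡ false × onA l ≡ true)
joined⇒opposite k l kl with onA k | onA l
... | true  | false = inj₁ (refl , refl)
... | false | true  = inj₂ (refl , refl)
... | true  | true  = case kl of λ ()
... | false | false = case kl of λ ()

joined-within-block : ∀ {k l} → onA k ≡ true → onA l ≡ false → inBlock₁ k ≡ inBlock₁ l →
  joined k l ≡ true
joined-within-block {k} {l} kA lB same rewrite kA | lB | same | xor-same (inBlock₁ l) = refl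

inForest-onB : ∀ k → inForest k ≡ true → onA k ≡ false → k ≡ c₁ ⊎ k ≡ c₂
inForest-onB c₁   _  _  = inj₁ refl
inForest-onB c₂   _  _  = inj₂ refl
inForest-onB hubA _  ()
inForest-onB a₁   _  ()
inForest-onB a₂   _  ()
inForest-onB hubB () _
inForest-onB b₁   () _
inForest-onB b₂   () _

layout : ℕ → ℕ → Layout Kind
layout e r = (e , hubA) ∷ (suc r , a₁) ∷ (suc r , a₂)
           ∷ (e , hubB) ∷ (1 , c₁) ∷ (r , b₁) ∷ (1 , c₂) ∷ (r , b₂) ∷ []

[1+p]+[1+q]≡n+2 : ∀ e r → suc (e + suc r) + suc (suc r) ≡ e + (suc r + suc r) + 2
[1+p]+[1+q]≡n+2 = solve-∀

module Construction (e r : ℕ) (e≤1 : e ≤ 1) where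

  n p : ℕ
  n = e + (suc r + suc r)
  p = e + suc r

  p+0≡p : e + (suc r + 0) ≡ p
  p+0≡p = cong (e +_) (+-identityʳ (suc r))

  ∣A-side∣ : countLabel (layout e r) onA ≡ n
  ∣A-side∣ = cong (λ x → e + (suc r + x)) (+-identityʳ (suc r))

  ∣B-side∣ : countLabel (layout e r) (not ∘ onA) ≡ n
  ∣B-side∣ = cong (λ x → e + suc (r + suc x)) (+-identityʳ r)

  span-layout : n + n ≡ span (layout e r)
  span-layout =
    sym (trans (span≡countLabel+countLabel¬ (layout e r) onA) (cong₂ _+_ ∣A-side∣ ∣B-side∣))

  kindOf : Fin (n + n) → Kind
  kindOf v = labelAt (layout e r) b₂ (toℕ v)

  graph : Graph (n + n)
  graph = record
    { adj    = λ u v → joined (kindOf u) (kindOf v)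
    ; sym    = λ u v → joined-sym (kindOf u) (kindOf v)
    ; irrefl = λ v → joined-irrefl (kindOf v)
    }

  ofKind : (Kind → Bool) → Subset (n + n)
  ofKind P = tabulate (P ∘ kindOf)

  ∣ofKind∣ : ∀ P → ∣ ofKind P ∣ ≡ countLabel (layout e r) P
  ∣ofKind∣ P = ∣tabulate∘labelAt∣ (layout e r) b₂ P span-layout

  ∣ofKind∩ofKind∣ : ∀ P Q → ∣ ofKind P ∩ ofKind Q ∣ ≡ countLabel (layout e r) (λ k → P k ∧ Q k)
  ∣ofKind∩ofKind∣ P Q =
    trans (cong ∣_∣ (tabulate-∩ (P ∘ kindOf) (Q ∘ kindOf))) (∣ofKind∣ (λ k → P k ∧ Q k))

  ∁-ofKind : ∀ P → ∁ (ofKind P) ≡ ofKind (not ∘ P)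
  ∁-ofKind P = tabulate-∁ (P ∘ kindOf)

  ofKind-unique : ∀ P → countLabel (layout e r) P ≤ 1 →
    ∀ {u w} → P (kindOf u) ≡ true → P (kindOf w) ≡ true → u ≡ w
  ofKind-unique P few Pu Pw =
    ∣p∣≤1⇒x≡y (subst (_≤ 1) (sym (∣ofKind∣ P)) few) (∈tabulate⁺ Pu) (∈tabulate⁺ Pw)

  vertex-a₁ : Σ (Fin (n + n)) λ v → kindOf v ≡ a₁
  vertex-a₁ = labelled-position (layout e r) b₂ span-layout ((e , hubA) ∷ []) refl

  vertex-c₁ : Σ (Fin (n + n)) λ v → kindOf v ≡ c₁
  vertex-c₁ = labelled-position (layout e r) b₂ span-layout
    ((e , hubA) ∷ (suc r , a₁) ∷ (suc r , a₂) ∷ (e , hubB) ∷ []) refl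

  vertex-c₂ : Σ (Fin (n + n)) λ v → kindOf v ≡ c₂
  vertex-c₂ = labelled-position (layout e r) b₂ span-layout
    ((e , hubA) ∷ (suc r , a₁) ∷ (suc r , a₂) ∷ (e , hubB) ∷ (1 , c₁) ∷ (r , b₁) ∷ []) refl

  balanced : BalancedBipartite n graph
  balanced = ofKind onA , trans (∣ofKind∣ onA) ∣A-side∣ , crossing
    where
    crossing : ∀ u v → Adjacent graph u v →
      (u ∈ ofKind onA × v ∉ ofKind onA) ⊎ (u ∉ ofKind onA × v ∈ ofKind onA)
    crossing u v uv with joined⇒opposite (kindOf u) (kindOf v) uv
    ... | inj₁ (uA , vB) = inj₁ (∈tabulate⁺ uA , ∉tabulate vB)
    ... | inj₂ (uB , vA) = inj₂ (∉tabulate uB , ∈tabulate⁺ vA)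

  p≤degree : ∀ k → p ≤ countLabel (layout e r) (joined k)
  p≤degree hubA = +-monoʳ-≤ e (s≤s (m≤m+n r _))
  p≤degree hubB = +-monoʳ-≤ e (m≤m+n (suc r) _)
  p≤degree a₁   = ≤-reflexive (sym p+0≡p)
  p≤degree a₂   = ≤-reflexive (sym p+0≡p)
  p≤degree c₁   = ≤-reflexive (sym p+0≡p)
  p≤degree b₁   = ≤-reflexive (sym p+0≡p)
  p≤degree c₂   = ≤-reflexive (sym p+0≡p)
  p≤degree b₂   = ≤-reflexive (sym p+0≡p)

  minDegree : MinDegree graph p
  minDegree = (v , degree-v) ,
              λ u → subst (p ≤_) (sym (∣ofKind∣ (joined (kindOf u)))) (p≤degree (kindOf u))
    where
    v : Fin (n + n)
    v = proj₁ vertex-a₁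
    degree-v : degree graph v ≡ p
    degree-v = begin
      ∣ ofKind (joined (kindOf v)) ∣              ≡⟨ ∣ofKind∣ (joined (kindOf v)) ⟩
      countLabel (layout e r) (joined (kindOf v)) ≡⟨ cong (countLabel (layout e r) ∘ joined) (proj₂ vertex-a₁) ⟩
      countLabel (layout e r) (joined a₁)         ≡⟨ p+0≡p ⟩
      p                                           ∎
      where open ≡-Reasoning

  S₀ : Subset (n + n)
  S₀ = ofKind inForest

  ∣S₀∣ : ∣ S₀ ∣ ≡ n + 2
  ∣S₀∣ = trans (∣ofKind∣ inForest)
               (sym (trans (+-assoc e _ 2) (cong (e +_) (+-assoc (suc r) (suc r) 2))))

  centre₁ centre₂ : Fin (n + n)
  centre₁ = proj₁ vertex-c₁
  centre₂ = proj₁ vertex-c₂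

  S₀-forest : InducesForest graph S₀
  S₀-forest = twoCentres⇒forest graph S₀ centre₁ centre₂ cover centres-apart shared
    where
    isCentre₁ isCentre₂ bothCentres : Kind → Bool
    isCentre₁ k   = isCentre k ∧ inBlock₁ k
    isCentre₂ k   = isCentre k ∧ not (inBlock₁ k)
    bothCentres k = joined k c₁ ∧ joined k c₂

    at-centre : ∀ {u} → u ∈ S₀ → onA (kindOf u) ≡ false → u ≡ centre₁ ⊎ u ≡ centre₂
    at-centre {u} u∈ uB with inForest-onB (kindOf u) (∈tabulate⁻ u∈) uB
    ... | inj₁ u₁ = inj₁ (ofKind-unique isCentre₁ ≤-refl (cong isCentre₁ u₁)
                                                         (cong isCentre₁ (proj₂ vertex-c₁)))
    ... | inj₂ u₂ = inj₂ (ofKind-unique isCentre₂ ≤-refl (cong isCentre₂ u₂)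
                                                         (cong isCentre₂ (proj₂ vertex-c₂)))

    cover : ∀ {u v} → u ∈ S₀ → v ∈ S₀ → Adjacent graph u v →
      (u ≡ centre₁ ⊎ u ≡ centre₂) ⊎ (v ≡ centre₁ ⊎ v ≡ centre₂)
    cover {u} {v} u∈ v∈ uv with joined⇒opposite (kindOf u) (kindOf v) uv
    ... | inj₁ (_ , vB) = inj₂ (at-centre v∈ vB)
    ... | inj₂ (uB , _) = inj₁ (at-centre u∈ uB)

    centres-apart : ¬ Adjacent graph centre₁ centre₂
    centres-apart c₁c₂ with trans (sym (cong₂ joined (proj₂ vertex-c₁) (proj₂ vertex-c₂))) c₁c₂
    ... | ()

    joined-to-centres : ∀ {u} → Adjacent graph u centre₁ → Adjacent graph u centre₂ →
      bothCentres (kindOf u) ≡ true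
    joined-to-centres {u} u₁ u₂ =
      cong₂ _∧_ (subst (λ k → joined (kindOf u) k ≡ true) (proj₂ vertex-c₁) u₁)
                (subst (λ k → joined (kindOf u) k ≡ true) (proj₂ vertex-c₂) u₂)

    shared : ∀ {u w} → u ∈ S₀ → w ∈ S₀ → Adjacent graph u centre₁ → Adjacent graph u centre₂ →
      Adjacent graph w centre₁ → Adjacent graph w centre₂ → u ≡ w
    shared _ _ u₁ u₂ w₁ w₂ =
      ofKind-unique bothCentres (subst (_≤ 1) (sym (+-identityʳ e)) e≤1)
        (joined-to-centres u₁ u₂) (joined-to-centres w₁ w₂)

  forest-bound : ∀ S → InducesForest graph S → ∣ S ∣ ≤ n + 2
  forest-bound S forest = begin
    ∣ S ∣                         ≡⟨ ∣p∣≡∣p∩q∣+∣p∩∁q∣ S W ⟩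
    ∣ S ∩ W ∣ + ∣ S ∩ ∁ W ∣       ≤⟨ +-mono-≤ block₁ block₂ ⟩
    suc p + suc (suc r)           ≡⟨ [1+p]+[1+q]≡n+2 e r ⟩
    n + 2                         ∎
    where
    open ≤-Reasoning
    W A : Subset (n + n)
    W = ofKind inBlock₁
    A = ofKind onA

    complete : ∀ {B} → (∀ {x y} → x ∈ B → y ∈ B → inBlock₁ (kindOf x) ≡ inBlock₁ (kindOf y)) →
      ∀ {x y} → x ∈ B ∩ A → y ∈ B ∩ ∁ A → Adjacent graph x y
    complete {B} sameBlock x∈ y∈ with x∈p∩q⁻ B A x∈ | x∈p∩q⁻ B (∁ A) y∈
    ... | xB , xA | yB , y∉A =
      joined-within-block (∈tabulate⁻ xA) (∈∁tabulate⁻ y∉A) (sameBlock xB yB)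

    size : ∀ P Q {k} → countLabel (layout e r) (λ k → P k ∧ Q k) ≡ k → ∣ ofKind P ∩ ofKind Q ∣ ≤ k
    size P Q eq = ≤-reflexive (trans (∣ofKind∩ofKind∣ P Q) eq)

    block₁ : ∣ S ∩ W ∣ ≤ suc p
    block₁ = forest-within-complete-bipartite graph forest
      (complete λ x∈ y∈ → trans (∈tabulate⁻ x∈) (sym (∈tabulate⁻ y∈)))
      (size inBlock₁ onA p+0≡p)
      (subst (λ X → ∣ W ∩ X ∣ ≤ p) (sym (∁-ofKind onA)) (size inBlock₁ (not ∘ onA) p+0≡p))

    block₂ : ∣ S ∩ ∁ W ∣ ≤ suc (suc r)
    block₂ = forest-within-complete-bipartite graph forest
      (complete λ x∈ y∈ → trans (∈∁tabulate⁻ x∈) (sym (∈∁tabulate⁻ y∈)))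
      (subst (λ X → ∣ X ∩ A ∣ ≤ suc r) (sym (∁-ofKind inBlock₁))
             (size (not ∘ inBlock₁) onA (+-identityʳ (suc r))))
      (subst₂ (λ X Y → ∣ X ∩ Y ∣ ≤ suc r) (sym (∁-ofKind inBlock₁)) (sym (∁-ofKind onA))
              (size (not ∘ inBlock₁) (not ∘ onA) (+-identityʳ (suc r))))

  forestNumber : ForestNumber graph (n + 2)
  forestNumber = (S₀ , S₀-forest , ∣S₀∣) , forest-bound

+-suc-double : ∀ e r → e + (suc r + suc r) ≡ 2 + (e + (r + r))
+-suc-double e r = begin
  e + suc (r + suc r)   ≡⟨ cong (λ x → e + suc x) (+-suc r r) ⟩
  e + suc (suc (r + r)) ≡⟨ +-suc e _ ⟩
  suc (e + suc (r + r)) ≡⟨ cong suc (+-suc e _) ⟩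
  2 + (e + (r + r))     ∎
  where open ≡-Reasoning

halve : ∀ n → 2 ≤ n → ∃₂ λ e r → e ≤ 1 × n ≡ e + (suc r + suc r)
halve 0 ()
halve 1 (s≤s ())
halve 2 _ = 0 , 0 , z≤n , refl
halve 3 _ = 1 , 0 , s≤s z≤n , refl
halve (suc (suc (suc (suc m)))) _ with halve (2 + m) (s≤s (s≤s z≤n))
... | e , r , e≤1 , eq = e , suc r , e≤1 , trans (cong (2 +_) eq) (sym (+-suc-double e (suc r)))

⌈e+[q+q]/2⌉≡e+q : ∀ {e} q → e ≤ 1 → ⌈ e + (q + q) /2⌉ ≡ e + q
⌈e+[q+q]/2⌉≡e+q zero z≤n       = refl
⌈e+[q+q]/2⌉≡e+q zero (s≤s z≤n) = refl
⌈e+[q+q]/2⌉≡e+q {e} (suc q) e≤1 = begin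
  ⌈ e + (suc q + suc q) /2⌉ ≡⟨ cong ⌈_/2⌉ (+-suc-double e q) ⟩
  ⌈ 2 + (e + (q + q)) /2⌉   ≡⟨ m/n≡1+[m∸n]/n {m = 3 + (e + (q + q))} (s≤s (s≤s z≤n)) ⟩
  suc ⌈ e + (q + q) /2⌉     ≡⟨ cong suc (⌈e+[q+q]/2⌉≡e+q q e≤1) ⟩
  suc (e + q)               ≡⟨ +-suc e q ⟨
  e + suc q                 ∎
  where open ≡-Reasoning

proposition1 : ∀ (n : ℕ) → 2 ≤ n →
    Σ (Graph (n + n)) λ B →
    BalancedBipartite n B × MinDegree B ⌈ n /2⌉ × ForestNumber B (n + 2)
proposition1 n 2≤n with halve n 2≤n
... | e , r , e≤1 , refl =
  graph , balanced , subst (MinDegree graph) (sym (⌈e+[q+q]/2⌉≡e+q (suc r) e≤1)) minDegree ,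
  forestNumber
  where open Construction e r e≤1
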